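{- Let $m,p,n$ be positive integers with $p\mid m$. For any integer $d$ with $0\le d<\lceil\frac{n-1}{2}\rceil$, we have $\mathrm{APS}_d(m,p,n)=\mathrm{APS}_d(m,1,n)$.
   Context: $[n]=\{1,\dots,n\}$, $\xi=e^{2\pi i/m}$; $\xi^a(x)$ denotes $\xi^a\cdot x$ for $0\le a\le m-1$, $x\in[n]$; $\mathbb{I}_n^m=\bigcup_{a=0}^{m-1}\{\xi^a(1),\dots,\xi^a(n)\}$, totally ordered by $\xi^a(x)\prec\xi^b(y)$ iff $a>b$, or $a=b$ and $x>y$. $\mathbb{Z}_m\wr S_n$ is the group of bijections $w$ of $\mathbb{I}_n^m$ with $w(\xi^i x)=\xi^i w(x)$ for $x\in[n]$, all $i$, written $w(n)\cdots w(1)$. $\operatorname{Pin}(w)=\{w(i):2\le i\le n-1,\ w(i+1)\prec w(i)\succ w(i-1)\}$. For $w$ with $w(i)=\xi^{e_i}(x_i)$, $e_i\in\{0,\dots,m-1\}$, set $\varepsilon_w=\sum_{i=1}^n e_i$. For $p\mid m$, the complex reflection group $G(m,p,n)$ is the subgroup $\{w\in\mathbb{Z}_m\wr S_n:\varepsilon_w\equiv0\pmod p\}$ (so $G(m,1,n)=\mathbb{Z}_m\wr S_n$). A set $P\subseteq\mathbb{I}_n^m$ is an admissible pinnacle set for $G(m,p,n)$ if $P=\operatorname{Pin}(w)$ for some $w\in G(m,p,n)$; $\mathrm{APS}_d(m,p,n)$ is the collection of such $P$ with $\#P\le d$. -}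

module Defs where

open import Data.Nat using (ℕ; zero; suc; _+_; _<_; _≤_)
open import Data.Nat.Divisibility using (_∣_)
open import Data.Nat.ListAction using (sum)
open import Data.Fin using (Fin; toℕ; fromℕ<)
open import Data.Fin.Permutation using (Permutation′; _⟨$⟩ʳ_)
open import Data.Product using (_×_; _,_; ∃; Σ; proj₁; proj₂)
open import Data.Sum using (_⊎_)
open import Data.Bool using (Bool; true; false; if_then_else_)
open import Data.List using (List; map; allFin)
open import Relation.Binary.PropositionalEquality using (_≡_)

-- The alphabet 𝕀ₙᵐ : the pair (a , x) stands for ξ^a(toℕ x + 1),
-- with 0 ≤ a ≤ m-1 and x ∈ [n] (shifted to Fin n).
𝕀 : ℕ → ℕ → Set
𝕀 m n = Fin m × Fin n

_≺_ : ∀ {m n} → 𝕀 m n → 𝕀 m n → Set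
(a , x) ≺ (b , y) = (toℕ b < toℕ a) ⊎ (a ≡ b × toℕ y < toℕ x)

-- An element of ℤ_m ≀ S_n, given by its window w(1), …, w(n):
-- w(i) = ξ^{e_i}(σ(i)) with σ ∈ S_n and e_i ∈ {0,…,m-1}.
-- (Position i ∈ [n] is represented by i-1 : Fin n.)
record Wreath (m n : ℕ) : Set where
  field
    expo : Fin n → Fin m
    perm : Permutation′ n

open Wreath public

value : ∀ {m n} → Wreath m n → Fin n → 𝕀 m n
value w i = expo w i , perm w ⟨$⟩ʳ i

ε : ∀ {m n} → Wreath m n → ℕ
ε {n = n} w = sum (map (λ i → toℕ (expo w i)) (allFin n))

InG : (m p n : ℕ) → Wreath m n → Set
InG m p n w = p ∣ ε w

-- z ∈ Pin(w): z = w(i) for some 2 ≤ i ≤ n-1 with w(i+1) ≺ w(i) ≻ w(i-1).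
-- Here j = i - 2 (0-based index of w(i-1)), so the positions
-- i-1, i, i+1 are (0-based) j, j+1, j+2.
InPin : ∀ {m n} → Wreath m n → 𝕀 m n → Set
InPin {n = n} w z =
  Σ ℕ λ j → Σ (j < n) λ h₀ → Σ (suc j < n) λ h₁ → Σ (suc (suc j) < n) λ h₂ →
    (value w (fromℕ< h₁) ≡ z)
    × (value w (fromℕ< h₂) ≺ value w (fromℕ< h₁))
    × (value w (fromℕ< h₀) ≺ value w (fromℕ< h₁))

Subset𝕀 : ℕ → ℕ → Set
Subset𝕀 m n = 𝕀 m n → Bool

card : ∀ {m n} → Subset𝕀 m n → ℕ
card {m} {n} P =
  sum (map (λ a → sum (map (λ x → if P (a , x) then 1 else 0) (allFin n))) (allFin m))

IsPinSet : ∀ {m n} → Subset𝕀 m n → Wreath m n → Set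
IsPinSet P w = ∀ z → (P z ≡ true → InPin w z) × (InPin w z → P z ≡ true)

InAPS : (d m p n : ℕ) → Subset𝕀 m n → Set
InAPS d m p n P = (∃ λ w → InG m p n w × IsPinSet P w) × card P ≤ d

{-# OPTIONS --safe #-}
-- Say #Pin(w) < ⌈(n-1)/2⌉. Then the window of w is not an alternating word a₀ ≺ b₁ ≻ a₁ ≺ ⋯ ≻ aₜ
-- with t pinnacles, so some letter (an initial descent, the middle of a monotone triple, or a
-- final ascent) can be deleted without changing the pinnacle set. The deleted letter is then given
-- any colour c and inserted again at a position that keeps the pinnacle set, and such a position
-- always exists. Choosing c ≡ −(colour sum of the other letters) mod m puts the new word in
-- G(m,m,n) ⊆ G(m,p,n).
module Submission where

open import Defs
open import Data.Bool using (true; if_then_else_)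
open import Data.Empty using (⊥; ⊥-elim)
open import Data.Fin using (Fin; zero; suc; toℕ; fromℕ<; punchIn)
open import Data.Fin.Permutation using (_⟨$⟩ʳ_; insert; id; _∘ₚ_; insert-punchIn)
open import Data.Fin.Properties as Fin using (punchInᵢ≢i; punchIn-injective; toℕ-fromℕ<; _≟_)
open import Data.List using (List; []; _∷_; _++_; [_]; length; map; tabulate; allFin; cartesianProduct)
open import Data.List.Membership.Propositional using (_∈_)
open import Data.List.Membership.Propositional.Properties using (∈-∃++; ∈-allFin; ∈-cartesianProduct⁺)
open import Data.List.Properties using (∷-injective; ++-assoc; tabulate-cong; map-tabulate; length-tabulate; map-++; map-∘)
open import Data.List.Relation.Binary.Permutation.Propositional.Properties using (shift; ∈-resp-↭; map⁺)
open import Data.List.Relation.Binary.Sublist.Propositional using (_⊆_; []; _∷_; _∷ʳ_)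
open import Data.List.Relation.Binary.Sublist.Propositional.Properties using (All-resp-⊆)
open import Data.List.Relation.Unary.All as All using (All; []; _∷_)
import Data.List.Relation.Unary.All.Properties as All
open import Data.List.Relation.Unary.AllPairs as AllPairs using (AllPairs; []; _∷_)
import Data.List.Relation.Unary.AllPairs.Properties as AllPairs
open import Data.List.Relation.Unary.Any using (here; there)
open import Data.Nat using (ℕ; zero; suc; _+_; _*_; _%_; _<_; _≤_; z≤n; s≤s; ⌈_/2⌉; _∸_; NonZero)
open import Data.Nat.Divisibility using (_∣_; ∣-trans; 1∣_; m%n≡0⇒n∣m)
open import Data.Nat.DivMod using (%-distribˡ-+; m%n%n≡m%n; m*n%n≡0; m%n<n)
open import Data.Nat.ListAction using (sum)
open import Data.Nat.ListAction.Properties using (sum-++; sum-↭)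
open import Data.Nat.Properties using (+-comm; *-comm; +-suc; +-mono-≤; ≤-trans; <⇒≱; suc-injective; n≡⌈n+n/2⌉; module ≤-Reasoning)
open import Data.Product as Prod using (Σ; _×_; _,_; proj₁; proj₂; ∃; ∃₂; ∃-syntax)
open import Data.Product.Relation.Binary.Lex.Strict using (×-isStrictTotalOrder)
open import Data.Product.Relation.Binary.Pointwise.NonDependent using (Pointwise)
open import Data.Sum as Sum using (_⊎_; inj₁; inj₂)
open import Data.Vec.Functional using (updateAt)
open import Data.Vec.Functional.Properties using (updateAt-updates; updateAt-minimal)
open import Function using (_∘_; const; _⇔_; mk⇔; Equivalence; Injection)
open import Function.Properties.Inverse using (↔⇒↣)
open import Function.Definitions using (Injective)
open import Level using (0ℓ)
open import Relation.Binary using (Rel; Transitive; Asymmetric; IsStrictTotalOrder; tri<; tri≈; tri>)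
import Relation.Binary.Construct.Flip.EqAndOrd as Flip
open import Relation.Binary.PropositionalEquality using (_≡_; _≢_; _≗_; refl; sym; trans; cong; cong₂; subst; module ≡-Reasoning)
open import Relation.Nullary using (¬_; yes; no)
open import Relation.Nullary.Negation using (contradiction)
open import Relation.Unary using (Pred; _≐_) renaming (_⊆_ to _⊆₁_)
open import Relation.Unary.Properties using (≐-sym; ≐-trans)

open Equivalence using (to; from)

private variable
  A : Set
  m n N : ℕ

module Pinnacles {A : Set} {_⊏_ : Rel A 0ℓ}
                 (⊏-trans : Transitive _⊏_) (⊏-asym : Asymmetric _⊏_) where

  Comparable : Rel A 0ℓ
  Comparable x y = x ⊏ y ⊎ y ⊏ x

  Comparable⇒≢ : ∀ {x y} → Comparable x y → x ≢ y
  Comparable⇒≢ (inj₁ x⊏y) refl = ⊏-asym x⊏y x⊏y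
  Comparable⇒≢ (inj₂ y⊏x) refl = ⊏-asym y⊏x y⊏x

  -- R is the part of the word after b, so b is no peak when R is empty.
  Peak : A → A → List A → Set
  Peak a b []      = ⊥
  Peak a b (c ∷ _) = a ⊏ b × c ⊏ b

  Peak⇒⊏ : ∀ {a b} R → Peak a b R → a ⊏ b
  Peak⇒⊏ (_ ∷ _) (a⊏b , _) = a⊏b

  Pins : List A → Pred A 0ℓ
  Pins (a ∷ b ∷ R) p = (b ≡ p × Peak a b R) ⊎ Pins (b ∷ R) p
  Pins _           p = ⊥

  -- InPin w is TabulatedPin (value w).
  TabulatedPin : ∀ {k} → (Fin k → A) → Pred A 0ℓ
  TabulatedPin {k} f z =
    Σ ℕ λ j → Σ (j < k) λ h₀ → Σ (suc j < k) λ h₁ → Σ (suc (suc j) < k) λ h₂ →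
      (f (fromℕ< h₁) ≡ z) × (f (fromℕ< h₂) ⊏ f (fromℕ< h₁)) × (f (fromℕ< h₀) ⊏ f (fromℕ< h₁))

  TabulatedPin⊆Pins : ∀ {k} (f : Fin k → A) → TabulatedPin f ⊆₁ Pins (tabulate f)
  TabulatedPin⊆Pins {suc (suc (suc k))} f (zero , _ , _ , _ , f₁≡z , f₂⊏f₁ , f₀⊏f₁) =
    inj₁ (f₁≡z , f₀⊏f₁ , f₂⊏f₁)
  TabulatedPin⊆Pins {suc (suc (suc k))} f (suc j , s≤s h₀ , s≤s h₁ , s≤s h₂ , pin) =
    inj₂ (TabulatedPin⊆Pins (f ∘ suc) (j , h₀ , h₁ , h₂ , pin))
  TabulatedPin⊆Pins {suc (suc zero)} f (_ , _ , _ , s≤s (s≤s ()) , _)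
  TabulatedPin⊆Pins {suc zero}       f (_ , _ , s≤s () , _)

  Pins⊆TabulatedPin : ∀ {k} (f : Fin k → A) → Pins (tabulate f) ⊆₁ TabulatedPin f
  Pins⊆TabulatedPin {suc (suc (suc k))} f (inj₁ (f₁≡z , f₀⊏f₁ , f₂⊏f₁)) =
    zero , s≤s z≤n , s≤s (s≤s z≤n) , s≤s (s≤s (s≤s z≤n)) , f₁≡z , f₂⊏f₁ , f₀⊏f₁
  Pins⊆TabulatedPin {suc (suc (suc k))} f (inj₂ pin) =
    let j , h₀ , h₁ , h₂ , rest = Pins⊆TabulatedPin (f ∘ suc) pin
    in suc j , s≤s h₀ , s≤s h₁ , s≤s h₂ , rest
  Pins⊆TabulatedPin {suc (suc zero)} f (inj₂ ())
  Pins⊆TabulatedPin {suc (suc zero)} f (inj₁ (_ , ()))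

  TabulatedPin≐Pins : ∀ {k} (f : Fin k → A) → TabulatedPin f ≐ Pins (tabulate f)
  TabulatedPin≐Pins f = TabulatedPin⊆Pins f , Pins⊆TabulatedPin f

  Pins-drop-head : ∀ {a b R} → ¬ Peak a b R → Pins (a ∷ b ∷ R) ≐ Pins (b ∷ R)
  Pins-drop-head ¬peak = (λ { (inj₁ (_ , peak)) → ⊥-elim (¬peak peak) ; (inj₂ pin) → pin }) , inj₂

  Pins-∷-cong : ∀ {x y c V W} → Pins (y ∷ c ∷ V) ≐ Pins (y ∷ c ∷ W) →
                Pins (x ∷ y ∷ c ∷ V) ≐ Pins (x ∷ y ∷ c ∷ W)
  Pins-∷-cong (V⊆W , W⊆V) = Sum.map₂ V⊆W , Sum.map₂ W⊆V

  Pins-++ˡ : ∀ pre {b V W} → (∀ {a} → Peak a b V ⇔ Peak a b W) →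
             Pins (b ∷ V) ≐ Pins (b ∷ W) → Pins (pre ++ b ∷ V) ≐ Pins (pre ++ b ∷ W)
  Pins-++ˡ []                _    V≐W         = V≐W
  Pins-++ˡ (_ ∷ [])          peak (V⊆W , W⊆V) =
    Sum.map (Prod.map₂ (to peak)) V⊆W , Sum.map (Prod.map₂ (from peak)) W⊆V
  Pins-++ˡ (_ ∷ y ∷ [])      peak V≐W         = Pins-∷-cong (Pins-++ˡ (y ∷ []) peak V≐W)
  Pins-++ˡ (_ ∷ y ∷ z ∷ pre) peak V≐W         = Pins-∷-cong (Pins-++ˡ (y ∷ z ∷ pre) peak V≐W)

  -- Inserting u between b and c keeps the pinnacle status of b and of c, and u is no pinnacle.
  record Spliceable (b u c : A) (R : List A) : Set where
    field
      left    : c ⊏ b ⇔ u ⊏ b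
      right   : Peak u c R ⇔ Peak b c R
      notPeak : ¬ Peak b u (c ∷ R)

  Pins-splice : ∀ pre {b u c R} → Spliceable b u c R →
                Pins (pre ++ b ∷ u ∷ c ∷ R) ≐ Pins (pre ++ b ∷ c ∷ R)
  Pins-splice pre {b} {u} {c} {R} s = Pins-++ˡ pre peak-cong
    ( (λ { (inj₁ (_ , peak)) → ⊥-elim (notPeak peak)
         ; (inj₂ (inj₁ (c≡p , peak))) → inj₁ (c≡p , to right peak)
         ; (inj₂ (inj₂ pin)) → inj₂ pin })
    , (λ { (inj₁ (c≡p , peak)) → inj₂ (inj₁ (c≡p , from right peak))
         ; (inj₂ pin) → inj₂ (inj₂ pin) }) )
    where
    open Spliceable s
    peak-cong : ∀ {a} → Peak a b (u ∷ c ∷ R) ⇔ Peak a b (c ∷ R)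
    peak-cong = mk⇔ (Prod.map₂ (from left)) (Prod.map₂ (to left))

  Peak-congˡ : ∀ {x y c} R → x ⊏ c ⇔ y ⊏ c → Peak x c R ⇔ Peak y c R
  Peak-congˡ []      _   = mk⇔ (λ ()) (λ ())
  Peak-congˡ (_ ∷ _) x⇔y = mk⇔ (Prod.map₁ (to x⇔y)) (Prod.map₁ (from x⇔y))

  Monotone : A → A → A → Set
  Monotone b y c = (b ⊏ y × y ⊏ c) ⊎ (c ⊏ y × y ⊏ b)

  monotone⇒spliceable : ∀ {b y c} R → Monotone b y c → Spliceable b y c R
  monotone⇒spliceable R (inj₁ (b⊏y , y⊏c)) = record
    { left    = mk⇔ (λ c⊏b → ⊥-elim (⊏-asym b⊏c c⊏b)) (λ y⊏b → ⊥-elim (⊏-asym b⊏y y⊏b))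
    ; right   = Peak-congˡ R (mk⇔ (λ _ → b⊏c) (λ _ → y⊏c))
    ; notPeak = λ { (_ , c⊏y) → ⊏-asym y⊏c c⊏y }
    }
    where b⊏c = ⊏-trans b⊏y y⊏c
  monotone⇒spliceable R (inj₂ (c⊏y , y⊏b)) = record
    { left    = mk⇔ (λ _ → y⊏b) (λ _ → c⊏b)
    ; right   = Peak-congˡ R (mk⇔ (λ y⊏c → ⊥-elim (⊏-asym c⊏y y⊏c)) (λ b⊏c → ⊥-elim (⊏-asym c⊏b b⊏c)))
    ; notPeak = λ { (b⊏y , _) → ⊏-asym y⊏b b⊏y }
    }
    where c⊏b = ⊏-trans c⊏y y⊏b

  valley⇒spliceable : ∀ {b u c} R → c ⊏ b → u ⊏ c → (∀ {a} → ¬ Peak a c R) → Spliceable b u c R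
  valley⇒spliceable R c⊏b u⊏c ¬peak = record
    { left    = mk⇔ (λ _ → ⊏-trans u⊏c c⊏b) (λ _ → c⊏b)
    ; right   = mk⇔ (⊥-elim ∘ ¬peak) (⊥-elim ∘ ¬peak)
    ; notPeak = λ { (b⊏u , _) → ⊏-asym (⊏-trans u⊏c c⊏b) b⊏u }
    }

  Removable : List A → Set
  Removable V = ∃[ pre ] ∃[ y ] ∃[ post ] V ≡ pre ++ y ∷ post × Pins (pre ++ post) ≐ Pins V

  Insertable : A → List A → Set
  Insertable u V = ∃₂ λ pre post → V ≡ pre ++ post × Pins (pre ++ u ∷ post) ≐ Pins V

  -- A list of length 2t+1 has at most t pinnacles; here t of them are exhibited.
  Saturated : List A → Set
  Saturated V = ∃[ l ] l ⊆ V × All (Pins V) l × length V ≡ suc (length l + length l)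

  data Deletable : List A → Set where
    monotone : ∀ pre {b y c} R → Monotone b y c → Deletable (pre ++ b ∷ y ∷ c ∷ R)
    final    : ∀ pre {a b} → ¬ b ⊏ a → Deletable (pre ++ a ∷ b ∷ [])

  deletable-∷ : ∀ {x V} → Deletable V → Deletable (x ∷ V)
  deletable-∷ {x} (monotone pre R mono) = monotone (x ∷ pre) R mono
  deletable-∷ {x} (final pre b⊀a)       = final (x ∷ pre) b⊀a

  deletable⇒removable : ∀ {V} → Deletable V → Removable V
  deletable⇒removable (monotone pre {b} {y} {c} R mono) =
    (pre ++ [ b ]) , y , c ∷ R , sym (++-assoc pre [ b ] (y ∷ c ∷ R)) ,
    subst (λ L → Pins L ≐ Pins (pre ++ b ∷ y ∷ c ∷ R)) (sym (++-assoc pre [ b ] (c ∷ R)))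
          (≐-sym (Pins-splice pre (monotone⇒spliceable R mono)))
  deletable⇒removable (final pre {a} {b} b⊀a) =
    (pre ++ [ a ]) , b , [] , sym (++-assoc pre [ a ] (b ∷ [])) ,
    subst (λ L → Pins L ≐ Pins (pre ++ a ∷ b ∷ [])) (sym (++-assoc pre [ a ] []))
          (≐-sym (Pins-++ˡ pre (mk⇔ (λ { (_ , b⊏a) → b⊀a b⊏a }) (λ ()))
                                ((λ { (inj₁ (_ , ())) ; (inj₂ ()) }) , (λ ()))))

  data Slot (u : A) : List A → Set where
    slot : ∀ pre {b c} R → Spliceable b u c R → Slot u (pre ++ b ∷ c ∷ R)

  slot-∷ : ∀ {u x V} → Slot u V → Slot u (x ∷ V)
  slot-∷ {x = x} (slot pre R s) = slot (x ∷ pre) R s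

  slot⇒insertable : ∀ {u V} → Slot u V → Insertable u V
  slot⇒insertable {u} (slot pre {b} {c} R s) =
    (pre ++ [ b ]) , c ∷ R , sym (++-assoc pre [ b ] (c ∷ R)) ,
    subst (λ L → Pins L ≐ Pins (pre ++ b ∷ c ∷ R)) (sym (++-assoc pre [ b ] (u ∷ c ∷ R))) (Pins-splice pre s)

  saturated-[_] : ∀ x → Saturated [ x ]
  saturated-[ x ] = [] , x ∷ʳ [] , [] , refl

  saturated-extend : ∀ {a b c V} → a ⊏ b → c ⊏ b → Saturated (c ∷ V) → Saturated (a ∷ b ∷ c ∷ V)
  saturated-extend {a} {b} a⊏b c⊏b (l , l⊆V , pins , |V|≡) =
    b ∷ l , a ∷ʳ (refl ∷ l⊆V) , inj₁ (refl , a⊏b , c⊏b) ∷ All.map (inj₂ ∘ inj₂) pins ,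
    cong (2 +_) (trans |V|≡ (sym (+-suc (length l) (length l))))

  -- Walks along the alternating prefix a₀ ⊏ b₁ ⊐ a₁ ⊏ b₂ ⊐ ⋯ until a monotone triple or a final ascent appears.
  deletable⊎saturated : ∀ {a b} S → a ⊏ b → AllPairs Comparable (a ∷ b ∷ S) →
                        Deletable (a ∷ b ∷ S) ⊎ Saturated (a ∷ b ∷ S)
  deletable⊎saturated []      a⊏b _ = inj₁ (final [] (⊏-asym a⊏b))
  deletable⊎saturated (c ∷ S) a⊏b (_ ∷ (inj₁ b⊏c ∷ _) ∷ _) = inj₁ (monotone [] S (inj₁ (a⊏b , b⊏c)))
  deletable⊎saturated (c ∷ []) a⊏b (_ ∷ (inj₂ c⊏b ∷ _) ∷ _) = inj₂ (saturated-extend a⊏b c⊏b saturated-[ c ])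
  deletable⊎saturated {a} (c ∷ d ∷ S) a⊏b (_ ∷ (inj₂ c⊏b ∷ _) ∷ (inj₂ d⊏c ∷ _) ∷ _) =
    inj₁ (monotone [ a ] S (inj₂ (d⊏c , c⊏b)))
  deletable⊎saturated (c ∷ d ∷ S) a⊏b (_ ∷ (inj₂ c⊏b ∷ _) ∷ cs@((inj₁ c⊏d ∷ _) ∷ _)) =
    Sum.map (deletable-∷ ∘ deletable-∷) (saturated-extend a⊏b c⊏b) (deletable⊎saturated S c⊏d cs)

  removable⊎saturated : ∀ a S → AllPairs Comparable (a ∷ S) → Removable (a ∷ S) ⊎ Saturated (a ∷ S)
  removable⊎saturated a [] _ = inj₁ ([] , a , [] , refl , (λ ()) , (λ ()))
  removable⊎saturated a (b ∷ S) ((inj₂ b⊏a ∷ _) ∷ _) =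
    inj₁ ([] , a , b ∷ S , refl , ≐-sym (Pins-drop-head (⊏-asym b⊏a ∘ Peak⇒⊏ S)))
  removable⊎saturated a (b ∷ S) cs@((inj₁ a⊏b ∷ _) ∷ _) =
    Sum.map₁ deletable⇒removable (deletable⊎saturated S a⊏b cs)

  slot⊎above : ∀ {u b} S → u ⊏ b → All (Comparable u) S → Slot u (b ∷ S) ⊎ All (u ⊏_) S
  slot⊎above []      _   _                = inj₂ []
  slot⊎above (c ∷ S) u⊏b (inj₂ c⊏u ∷ _)   = inj₁ (slot [] S (monotone⇒spliceable S (inj₂ (c⊏u , u⊏b))))
  slot⊎above (c ∷ S) _   (inj₁ u⊏c ∷ cmp) = Sum.map slot-∷ (u⊏c ∷_) (slot⊎above S u⊏c cmp)

  slot-below-descent : ∀ {u b c} S → c ⊏ b → u ⊏ c → All (u ⊏_) S → AllPairs Comparable (c ∷ S) →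
                       Slot u (b ∷ c ∷ S)
  slot-below-descent [] c⊏b u⊏c _ _ = slot [] [] (valley⇒spliceable [] c⊏b u⊏c (λ ()))
  slot-below-descent (d ∷ S) c⊏b u⊏c _ ((inj₁ c⊏d ∷ _) ∷ _) =
    slot [] (d ∷ S) (valley⇒spliceable (d ∷ S) c⊏b u⊏c (λ { (_ , d⊏c) → ⊏-asym c⊏d d⊏c }))
  slot-below-descent (d ∷ S) _ _ (u⊏d ∷ u⊏S) ((inj₂ d⊏c ∷ _) ∷ cs) =
    slot-∷ (slot-below-descent S d⊏c u⊏d u⊏S cs)

  insertable-minimum : ∀ {u v} R → All (u ⊏_) (v ∷ R) → AllPairs Comparable (v ∷ R) → Insertable u (v ∷ R)
  insertable-minimum {u} {v} [] _ _ = [] , _ , refl , Pins-drop-head {u} {v} (λ ())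
  insertable-minimum (v₁ ∷ R) _ ((inj₁ v⊏v₁ ∷ _) ∷ _) =
    [] , _ , refl , Pins-drop-head (λ { (_ , v₁⊏v) → ⊏-asym v⊏v₁ v₁⊏v })
  insertable-minimum (v₁ ∷ R) (_ ∷ u⊏v₁ ∷ u⊏R) ((inj₂ v₁⊏v ∷ _) ∷ cs) =
    slot⇒insertable (slot-below-descent R v₁⊏v u⊏v₁ u⊏R cs)

  insertable : ∀ {u} V → All (Comparable u) V → AllPairs Comparable V → Insertable u V
  insertable [] _ _ = [] , [] , refl , (λ ()) , (λ ())
  insertable (v ∷ V) (inj₂ v⊏u ∷ _) _ = [] , v ∷ V , refl , Pins-drop-head (⊏-asym v⊏u ∘ Peak⇒⊏ V)
  insertable (v ∷ V) (inj₁ u⊏v ∷ cmp) cs with slot⊎above V u⊏v cmp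
  ... | inj₁ s   = slot⇒insertable s
  ... | inj₂ u⊏V = insertable-minimum V (u⊏v ∷ u⊏V) cs

AllPairs-resp-⊆ : ∀ {R : Rel A 0ℓ} {l V} → l ⊆ V → AllPairs R V → AllPairs R l
AllPairs-resp-⊆ []           []       = []
AllPairs-resp-⊆ (_ ∷ʳ l⊆V)   (_ ∷ rs) = AllPairs-resp-⊆ l⊆V rs
AllPairs-resp-⊆ (refl ∷ l⊆V) (r ∷ rs) = All-resp-⊆ l⊆V r ∷ AllPairs-resp-⊆ l⊆V rs

length≤sum : (f : A → ℕ) (E : List A) {l : List A} →
             AllPairs _≢_ l → All (_∈ E) l → All (λ x → 1 ≤ f x) l → length l ≤ sum (map f E)
length≤sum f E [] [] [] = z≤n
length≤sum f E {x ∷ l} (x∉l ∷ distinct) (x∈E ∷ l⊆E) (1≤fx ∷ 1≤fl)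
  with E₁ , E₂ , refl ← ∈-∃++ x∈E = begin
    1 + length l                    ≤⟨ +-mono-≤ 1≤fx (length≤sum f (E₁ ++ E₂) distinct l⊆E₁E₂ 1≤fl) ⟩
    f x + sum (map f (E₁ ++ E₂))    ≡⟨ sum-↭ (map⁺ f (shift x E₁ E₂)) ⟨
    sum (map f (E₁ ++ x ∷ E₂))      ∎
  where
  open ≤-Reasoning
  ∈-without-x : ∀ {y} → x ≢ y → y ∈ E₁ ++ x ∷ E₂ → y ∈ E₁ ++ E₂
  ∈-without-x x≢y y∈E with ∈-resp-↭ (shift x E₁ E₂) y∈E
  ... | here refl = contradiction refl x≢y
  ... | there y∈E₁E₂ = y∈E₁E₂
  l⊆E₁E₂ : All (_∈ E₁ ++ E₂) l
  l⊆E₁E₂ = All.zipWith (λ (x≢y , y∈E) → ∈-without-x x≢y y∈E) (x∉l , l⊆E)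

sum-cartesianProduct : ∀ {B : Set} (g : A × B → ℕ) as bs →
                       sum (map (λ a → sum (map (λ b → g (a , b)) bs)) as) ≡ sum (map g (cartesianProduct as bs))
sum-cartesianProduct g []       bs = refl
sum-cartesianProduct g (a ∷ as) bs = begin
  sum (map (g ∘ (a ,_)) bs) + sum (map (λ a → sum (map (λ b → g (a , b)) bs)) as)
    ≡⟨ cong₂ _+_ (cong sum (map-∘ bs)) (sum-cartesianProduct g as bs) ⟩
  sum (map g (map (a ,_) bs)) + sum (map g (cartesianProduct as bs))
    ≡⟨ sum-++ (map g (map (a ,_) bs)) _ ⟨
  sum (map g (map (a ,_) bs) ++ map g (cartesianProduct as bs))
    ≡⟨ cong sum (map-++ g (map (a ,_) bs) _) ⟨
  sum (map g (cartesianProduct (a ∷ as) bs))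
    ∎
  where open ≡-Reasoning

tabulate-remove : ∀ (f : Fin (suc N) → A) {pre y post} → tabulate f ≡ pre ++ y ∷ post →
                  ∃ λ i → tabulate (f ∘ punchIn i) ≡ pre ++ post
tabulate-remove f {[]} f≡ = zero , proj₂ (∷-injective f≡)
tabulate-remove {N = suc N} f {x ∷ pre} f≡
  with i , rest≡ ← tabulate-remove (f ∘ suc) (proj₂ (∷-injective f≡)) =
  suc i , cong₂ _∷_ (proj₁ (∷-injective f≡)) rest≡
tabulate-remove {N = zero} f {_ ∷ []}    ()
tabulate-remove {N = zero} f {_ ∷ _ ∷ _} ()

tabulate-insert : ∀ (g : Fin N → A) {pre post} → tabulate g ≡ pre ++ post →
                  ∃ λ k → ∀ f → f ∘ punchIn k ≗ g → tabulate f ≡ pre ++ f k ∷ post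
tabulate-insert g {[]} g≡ = zero , λ f f≗g → cong (f zero ∷_) (trans (tabulate-cong f≗g) g≡)
tabulate-insert {N = suc N} g {x ∷ pre} g≡
  with k , build ← tabulate-insert (g ∘ suc) (proj₂ (∷-injective g≡)) =
  suc k , λ f f≗g → cong₂ _∷_ (trans (f≗g zero) (proj₁ (∷-injective g≡))) (build (f ∘ suc) (f≗g ∘ suc))
tabulate-insert {N = zero} g {_ ∷ _} ()

1+m∣[m*n]%[1+m]+n : ∀ m n → suc m ∣ m * n % suc m + n
1+m∣[m*n]%[1+m]+n m n = m%n≡0⇒n∣m _ (suc m) (begin
  (m * n % suc m + n) % suc m                    ≡⟨ %-distribˡ-+ (m * n % suc m) n (suc m) ⟩
  (m * n % suc m % suc m + n % suc m) % suc m    ≡⟨ cong (λ r → (r + n % suc m) % suc m) (m%n%n≡m%n (m * n) (suc m)) ⟩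
  (m * n % suc m + n % suc m) % suc m            ≡⟨ %-distribˡ-+ (m * n) n (suc m) ⟨
  (m * n + n) % suc m                            ≡⟨ cong (_% suc m) (trans (+-comm (m * n) n) (*-comm (suc m) n)) ⟩
  n * suc m % suc m                              ≡⟨ m*n%n≡0 n (suc m) ⟩
  0                                              ∎)
  where open ≡-Reasoning

-- Defs' _≺_ is, definitionally, the lexicographic order on Fin m × Fin n with both components reversed.
≺-isStrictTotalOrder : IsStrictTotalOrder (Pointwise _≡_ _≡_) (_≺_ {m} {n})
≺-isStrictTotalOrder = ×-isStrictTotalOrder (Flip.isStrictTotalOrder Fin.<-isStrictTotalOrder)
                                            (Flip.isStrictTotalOrder Fin.<-isStrictTotalOrder)

module 𝕀-Pinnacles {m n : ℕ} = Pinnacles {_⊏_ = _≺_ {m} {n}}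
  (IsStrictTotalOrder.trans ≺-isStrictTotalOrder) (IsStrictTotalOrder.asym ≺-isStrictTotalOrder)
open 𝕀-Pinnacles

comparable : {x y : 𝕀 m n} → proj₂ x ≢ proj₂ y → Comparable x y
comparable {x = x} {y} x₂≢y₂ with IsStrictTotalOrder.compare ≺-isStrictTotalOrder x y
... | tri< x≺y _ _         = inj₁ x≺y
... | tri≈ _ (_ , x₂≡y₂) _ = contradiction x₂≡y₂ x₂≢y₂
... | tri> _ _ y≺x         = inj₂ y≺x

tabulate-comparable : ∀ {k} (f : Fin k → 𝕀 m n) → Injective _≡_ _≡_ (proj₂ ∘ f) →
                      AllPairs Comparable (tabulate f)
tabulate-comparable f inj = AllPairs.tabulate⁺ (λ i≢j → comparable (i≢j ∘ inj))

window : Wreath m n → List (𝕀 m n)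
window w = tabulate (value w)

windowWithout : Wreath m (suc N) → Fin (suc N) → List (𝕀 m (suc N))
windowWithout w i = tabulate (value w ∘ punchIn i)

InPin≐Pins : (w : Wreath m n) → InPin w ≐ Pins (window w)
InPin≐Pins w = TabulatedPin≐Pins (value w)

perm-injective : (w : Wreath m n) → Injective _≡_ _≡_ (perm w ⟨$⟩ʳ_)
perm-injective w = Injection.injective (↔⇒↣ (perm w))

window-comparable : (w : Wreath m n) → AllPairs Comparable (window w)
window-comparable w = tabulate-comparable (value w) (perm-injective w)

colourSum : List (𝕀 m n) → ℕ
colourSum = sum ∘ map (toℕ ∘ proj₁)

ε≡colourSum : (w : Wreath m n) → ε w ≡ colourSum (window w)
ε≡colourSum w = cong sum (trans (map-tabulate (λ i → i) _) (sym (map-tabulate (value w) _)))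

colourSum-insert : ∀ pre (u : 𝕀 m n) post →
                   colourSum (pre ++ u ∷ post) ≡ toℕ (proj₁ u) + colourSum (pre ++ post)
colourSum-insert pre u post = sum-↭ (map⁺ (toℕ ∘ proj₁) (shift u pre post))

insert-self : ∀ (k i : Fin (suc N)) → insert k i id ⟨$⟩ʳ k ≡ i
insert-self k i with k ≟ k
... | yes _  = refl
... | no k≢k = contradiction refl k≢k

-- w with its letter at position i moved to position k and recoloured c.
relocate : Wreath m (suc N) → (i k : Fin (suc N)) → Fin m → Wreath m (suc N)
relocate w i k c = record
  { expo = updateAt (expo w ∘ (τ ⟨$⟩ʳ_)) k (const c)
  ; perm = τ ∘ₚ perm w
  }
  where τ = insert k i id

relocate-at : ∀ (w : Wreath m (suc N)) i k c → value (relocate w i k c) k ≡ (c , perm w ⟨$⟩ʳ i)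
relocate-at w i k c = cong₂ _,_ (updateAt-updates k _) (cong (perm w ⟨$⟩ʳ_) (insert-self k i))

relocate-punchIn : ∀ (w : Wreath m (suc N)) i k c → value (relocate w i k c) ∘ punchIn k ≗ value w ∘ punchIn i
relocate-punchIn w i k c j =
  cong₂ _,_ (trans (updateAt-minimal (punchIn k j) k _ (punchInᵢ≢i k j)) (cong (expo w) τj))
            (cong (perm w ⟨$⟩ʳ_) τj)
  where τj = insert-punchIn k i id j

reinsert : ∀ (w : Wreath m (suc N)) i c {pre post} → windowWithout w i ≡ pre ++ post →
           ∃ λ w′ → window w′ ≡ pre ++ (c , perm w ⟨$⟩ʳ i) ∷ post
reinsert w i c {pre} {post} rest≡ with k , build ← tabulate-insert (value w ∘ punchIn i) rest≡ =
  relocate w i k c ,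
  trans (build (value (relocate w i k c)) (relocate-punchIn w i k c))
        (cong (λ z → pre ++ z ∷ post) (relocate-at w i k c))

ε-window : ∀ (w : Wreath m n) {pre u post R} → window w ≡ pre ++ u ∷ post → R ≡ pre ++ post →
           ε w ≡ toℕ (proj₁ u) + colourSum R
ε-window w {pre} {u} {post} {R} window≡ R≡ = begin
  ε w                                      ≡⟨ ε≡colourSum w ⟩
  colourSum (window w)                     ≡⟨ cong colourSum window≡ ⟩
  colourSum (pre ++ u ∷ post)              ≡⟨ colourSum-insert pre u post ⟩
  toℕ (proj₁ u) + colourSum (pre ++ post)  ≡⟨ cong (λ V → toℕ (proj₁ u) + colourSum V) R≡ ⟨
  toℕ (proj₁ u) + colourSum R              ∎
  where open ≡-Reasoning

recolour : ∀ (w : Wreath m (suc N)) i c →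
           ∃ λ w′ → ε w′ ≡ toℕ c + colourSum (windowWithout w i) × Pins (window w′) ≐ Pins (windowWithout w i)
recolour w i c =
  let pre , post , rest≡ , insertion = insertable (windowWithout w i) new-comparable rest-comparable
      w′ , window≡ = reinsert w i c rest≡
  in w′ , ε-window w′ window≡ rest≡ , subst (λ V → Pins V ≐ Pins (windowWithout w i)) (sym window≡) insertion
  where
  new-comparable : All (Comparable (c , perm w ⟨$⟩ʳ i)) (windowWithout w i)
  new-comparable = All.tabulate⁺ (λ j → comparable (punchInᵢ≢i i j ∘ sym ∘ perm-injective w))
  rest-comparable : AllPairs Comparable (windowWithout w i)
  rest-comparable = tabulate-comparable (value w ∘ punchIn i) (punchIn-injective i _ _ ∘ perm-injective w)

-- The new colour c ≡ m·S ≡ −S (mod 1+m) cancels the colour sum S of the remaining letters.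
balance : ∀ (w : Wreath (suc m) (suc N)) i → Pins (windowWithout w i) ≐ Pins (window w) →
          ∃ λ w′ → suc m ∣ ε w′ × InPin w′ ≐ InPin w
balance {m} w i deletion =
  let S = colourSum (windowWithout w i)
      c = fromℕ< (m%n<n (m * S) (suc m))
      w′ , ε≡ , insertion = recolour w i c
  in w′ , subst (suc m ∣_) (sym (trans ε≡ (cong (_+ S) (toℕ-fromℕ< _)))) (1+m∣[m*n]%[1+m]+n m S) ,
     ≐-trans (InPin≐Pins w′) (≐-trans insertion (≐-trans deletion (≐-sym (InPin≐Pins w))))

removable⇒position : (w : Wreath m (suc N)) → Removable (window w) →
                     ∃ λ i → Pins (windowWithout w i) ≐ Pins (window w)
removable⇒position w (pre , y , post , split , deletion) =
  Prod.map₂ (λ rest≡ → subst (λ V → Pins V ≐ Pins (window w)) (sym rest≡) deletion)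
            (tabulate-remove (value w) split)

length≤card : (P : Subset𝕀 m n) {l : List (𝕀 m n)} →
              AllPairs _≢_ l → All (λ z → P z ≡ true) l → length l ≤ card P
length≤card {m} {n} P {l} distinct inP =
  subst (length l ≤_) (sym (sum-cartesianProduct bit (allFin m) (allFin n)))
        (length≤sum bit _ distinct (All.universal everywhere l) (All.map 1≤bit inP))
  where
  bit : 𝕀 m n → ℕ
  bit z = if P z then 1 else 0
  everywhere : ∀ (z : 𝕀 m n) → z ∈ cartesianProduct (allFin m) (allFin n)
  everywhere (a , x) = ∈-cartesianProduct⁺ (∈-allFin a) (∈-allFin x)
  1≤bit : ∀ {z} → P z ≡ true → 1 ≤ bit z
  1≤bit Pz rewrite Pz = s≤s z≤n

saturated⇒⌈N/2⌉≤card : ∀ {P : Subset𝕀 m (suc N)} w → IsPinSet P w → Saturated (window w) → ⌈ N /2⌉ ≤ card P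
saturated⇒⌈N/2⌉≤card {N = N} {P} w w↦P (l , l⊆window , pins , |window|≡) =
  subst (_≤ card P) |l|≡⌈N/2⌉ (length≤card P distinct (All.map (proj₂ (w↦P _) ∘ proj₂ (InPin≐Pins w)) pins))
  where
  distinct : AllPairs _≢_ l
  distinct = AllPairs.map Comparable⇒≢ (AllPairs-resp-⊆ l⊆window (window-comparable w))
  |l|≡⌈N/2⌉ : length l ≡ ⌈ N /2⌉
  |l|≡⌈N/2⌉ = trans (n≡⌈n+n/2⌉ (length l))
                    (cong ⌈_/2⌉ (suc-injective (trans (sym |window|≡) (length-tabulate (value w)))))

IsPinSet-resp : ∀ {P : Subset𝕀 m n} w w′ → InPin w′ ≐ InPin w → IsPinSet P w → IsPinSet P w′
IsPinSet-resp w w′ (w′⊆w , w⊆w′) w↦P z = (w⊆w′ ∘ proj₁ (w↦P z)) , (proj₂ (w↦P z) ∘ w′⊆w)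

mainTheorem14 : (m p n : ℕ) → NonZero m → NonZero p → NonZero n → p ∣ m →
    (d : ℕ) → d < ⌈ (n ∸ 1) /2⌉ →
    (P : Subset𝕀 m n) → (InAPS d m p n P → InAPS d m 1 n P) × (InAPS d m 1 n P → InAPS d m p n P)
mainTheorem14 (suc m) p (suc N) _ _ _ p∣m d d<⌈N/2⌉ P = G⇒G₁ , G₁⇒G
  where
  G⇒G₁ : InAPS d (suc m) p (suc N) P → InAPS d (suc m) 1 (suc N) P
  G⇒G₁ ((w , _ , w↦P) , #P≤d) = (w , 1∣ ε w , w↦P) , #P≤d
  G₁⇒G : InAPS d (suc m) 1 (suc N) P → InAPS d (suc m) p (suc N) P
  G₁⇒G ((w , _ , w↦P) , #P≤d) with removable⊎saturated _ _ (window-comparable w)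
  ... | inj₁ removable =
    let i , deletion = removable⇒position w removable
        w′ , 1+m∣ε , samePins = balance w i deletion
    in (w′ , ∣-trans p∣m 1+m∣ε , IsPinSet-resp w w′ samePins w↦P) , #P≤d
  ... | inj₂ saturated =
    contradiction (≤-trans (saturated⇒⌈N/2⌉≤card w w↦P saturated) #P≤d) (<⇒≱ d<⌈N/2⌉)
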